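{- Let $\pi$ be a nonsingular biaffine mapping $V_n\times V_n\to V_n$, $g\in\mathcal{F}_n$, $\varphi\in\mathcal{F}_{2n}$, and suppose all restrictions of $\varphi(\vec{u},\vec{v})$ to $\vec{u}\in V_n$ (for fixed $\vec v$) and to $\vec{v}\in V_n$ (for fixed $\vec u$) are affine functions. Then the square $S(\vec{u},\vec{v})=\chi(\varphi(\vec{u},\vec{v}))\,\widehat{g}(\pi(\vec{u},\vec{v}))$, $\vec u,\vec v\in V_n$, is a bent square, i.e. for each fixed $\vec u$ the map $\vec v\mapsto S(\vec u,\vec v)$ and for each fixed $\vec v$ the map $\vec u\mapsto S(\vec u,\vec v)$ are Walsh–Hadamard transforms of functions in $\mathcal F_n$ (equivalently, $S$ is the rectangle $R_f(\vec u,\vec v)=\sum_{\vec y\in V_n}\chi(f(\vec u,\vec y))\overline{\chi(\vec v\cdot\vec y)}$ of some regular bent function $f\in\mathcal F_{2n}$).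
   Context: Let $q\ge2$, $\mathbb{Z}_q$ the integers modulo $q$, $\chi(a)=\exp(2\pi i a/q)$, $V_n=\mathbb{Z}_q^n$, $\mathcal{F}_n$ the set of functions $V_n\to\mathbb{Z}_q$, and for $g\in\mathcal F_n$ let $\widehat{g}(\vec{u})=\sum_{\vec{x}\in V_n}\chi(g(\vec{x}))\overline{\chi(\vec{u}\cdot\vec{x})}$ be its Walsh–Hadamard transform. A mapping $\pi\colon V_n\times V_n\to V_n$ is biaffine if for each fixed $\vec v$ the map $\vec u\mapsto\pi(\vec u,\vec v)$ and for each fixed $\vec u$ the map $\vec v\mapsto\pi(\vec u,\vec v)$ are affine transformations of $V_n$; it is nonsingular if all these restrictions are invertible. A function $f\in\mathcal F_m$ is regular bent if $\widehat f(\vec u)\in q^{m/2}\{\zeta:\zeta^q=1\}$ for all $\vec u$. -}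

module Defs where

open import Level using (Level)
open import Data.Nat as ℕ using (ℕ; zero; suc; NonZero)
open import Data.Nat.DivMod using (_mod_)
open import Data.Fin using (Fin; toℕ)
open import Data.Vec.Functional using (Vector; _∷_)
open import Data.Product using (Σ; _×_; _,_)
open import Relation.Binary.PropositionalEquality using (_≡_)
open import Algebra.Bundles using (CommutativeRing)

module _ (q : ℕ) .{{_ : NonZero q}} where

  Zq : Set
  Zq = Fin q

  0q : Zq
  0q = 0 mod q

  _⊕_ : Zq → Zq → Zq
  a ⊕ b = (toℕ a ℕ.+ toℕ b) mod q

  _⊗_ : Zq → Zq → Zq
  a ⊗ b = (toℕ a ℕ.* toℕ b) mod q

  ⊖_ : Zq → Zq
  ⊖ a = (q ℕ.∸ toℕ a) mod q

  sumZ : (m : ℕ) → (Fin m → Zq) → Zq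
  sumZ zero    f = 0q
  sumZ (suc m) f = f Data.Fin.zero ⊕ sumZ m (λ i → f (Data.Fin.suc i))

  V : ℕ → Set
  V n = Vector Zq n

  dot : (n : ℕ) → V n → V n → Zq
  dot n u x = sumZ n (λ i → u i ⊗ x i)

  _+V_ : {n : ℕ} → V n → V n → V n
  (x +V y) i = x i ⊕ y i

  Mat : ℕ → Set
  Mat n = Fin n → Fin n → Zq

  matVec : (n : ℕ) → Mat n → V n → V n
  matVec n A x i = sumZ n (λ j → A i j ⊗ x j)

  IsAffineMap : (n : ℕ) → (V n → V n) → Set
  IsAffineMap n T =
    Σ (Mat n) λ A → Σ (V n) λ b → ∀ x i → T x i ≡ (matVec n A x +V b) i

  IsInvertible : (n : ℕ) → (V n → V n) → Set
  IsInvertible n T =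
    Σ (V n → V n) λ T' → (∀ x i → T (T' x) i ≡ x i) × (∀ x i → T' (T x) i ≡ x i)

  IsAffineTransformation : (n : ℕ) → (V n → V n) → Set
  IsAffineTransformation = IsAffineMap

  Biaffine : (n : ℕ) → (V n → V n → V n) → Set
  Biaffine n π =
    (∀ v → IsAffineTransformation n (λ u → π u v)) ×
    (∀ u → IsAffineTransformation n (λ v → π u v))

  Nonsingular : (n : ℕ) → (V n → V n → V n) → Set
  Nonsingular n π =
    (∀ v → IsInvertible n (λ u → π u v)) ×
    (∀ u → IsInvertible n (λ v → π u v))

  IsAffineFunction : (n : ℕ) → (V n → Zq) → Set
  IsAffineFunction n f = Σ (V n) λ c → Σ Zq λ d → ∀ x → f x ≡ dot n c x ⊕ d

  BiaffineFunction : (n : ℕ) → (V n → V n → Zq) → Set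
  BiaffineFunction n φ =
    (∀ v → IsAffineFunction n (λ u → φ u v)) ×
    (∀ u → IsAffineFunction n (λ v → φ u v))

-- Character values, Walsh–Hadamard transform, bent squares,
-- valued in a commutative ring R containing a q-th root of unity ζ
-- (the paper's setting is R = ℂ, ζ = exp(2πi/q)).

module _ {c ℓ : Level} (R : CommutativeRing c ℓ) where
  open CommutativeRing R

  pow : Carrier → ℕ → Carrier
  pow x zero    = 1#
  pow x (suc k) = x * pow x k

  module _ (q : ℕ) .{{_ : NonZero q}} (ζ : Carrier) where

    χ : Zq q → Carrier
    χ a = pow ζ (toℕ a)

    sumFin : (m : ℕ) → (Fin m → Carrier) → Carrier
    sumFin zero    f = 0#
    sumFin (suc m) f = f Data.Fin.zero + sumFin m (λ i → f (Data.Fin.suc i))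

    sumV : (n : ℕ) → (V q n → Carrier) → Carrier
    sumV zero    F = F (λ ())
    sumV (suc n) F = sumFin q (λ a → sumV n (λ x → F (a ∷ x)))

    -- ĝ(u) = Σ_x χ(g(x)) · conj(χ(u·x)),  with conj(χ(b)) = χ(-b)
    WHT : (n : ℕ) → (V q n → Zq q) → V q n → Carrier
    WHT n g u = sumV n (λ x → χ (g x) * χ (⊖_ q (dot q n u x)))

    BentSquare : (n : ℕ) → (V q n → V q n → Carrier) → Set ℓ
    BentSquare n S =
      (∀ u → Σ (V q n → Zq q) λ h → ∀ v → S u v ≈ WHT n h v) ×
      (∀ v → Σ (V q n → Zq q) λ h → ∀ u → S u v ≈ WHT n h u)

module Submission where

-- Every row and every column of S has the form v ↦ χ(ψ(v))·ĝ(T v) with T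
-- an invertible affine map of V_n and ψ an affine function, so the theorem
-- is two applications of one lemma (WHT-affine-twist): such a twist of ĝ
-- is again a Walsh–Hadamard transform ĥ.  Writing T v = A v + b and
-- ψ v = c·v + d, the identity (A v)·x = v·(Aᵀx) and the substitution
-- y = Aᵀx − c turn the sum for χ(ψ(v))·ĝ(T v) into the sum for ĥ(v), where
-- h(y) = g(x) + d − b·x.

open import Defs
open import Level using (Level; 0ℓ)
open import Data.Nat using (ℕ; NonZero; _≤_)
open import Algebra.Bundles using (CommutativeRing)
open import Data.Product using (_,_)

module IntegersModulo (q : ℕ) .{{_ : NonZero q}} where

  open import Data.Nat as ℕ using (_%_)
  import Data.Nat.Properties as ℕₚ
  open import Data.Nat.DivMod using (_mod_; %-distribˡ-+; %-distribˡ-*; n%n≡0; m%n≤m; m<n⇒m%n≡m)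
  open import Data.Fin using (toℕ)
  open import Data.Fin.Properties using (toℕ<n; toℕ-fromℕ<; toℕ-injective; fromℕ<-cong)
  open import Relation.Binary.PropositionalEquality
  open import Algebra.Consequences.Propositional
    using (comm∧idˡ⇒id; comm∧invˡ⇒inv; comm∧distrˡ⇒distrʳ)
  open ≡-Reasoning

  private
    _+_ = _⊕_ q
    _*_ = _⊗_ q
    -_  = ⊖_ q
    infixl 6 _+_
    infixl 7 _*_

  ⟦_⟧ : ℕ → Zq q
  ⟦ m ⟧ = m mod q

  toℕ-⟦⟧ : ∀ m → toℕ ⟦ m ⟧ ≡ m % q
  toℕ-⟦⟧ m = toℕ-fromℕ< _

  ⟦toℕ⟧ : ∀ a → ⟦ toℕ a ⟧ ≡ a
  ⟦toℕ⟧ a = toℕ-injective (trans (toℕ-⟦⟧ (toℕ a)) (m<n⇒m%n≡m (toℕ<n a)))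

  ⟦⟧-cong : ∀ {m n} → m % q ≡ n % q → ⟦ m ⟧ ≡ ⟦ n ⟧
  ⟦⟧-cong e = fromℕ<-cong _ _ e _ _

  -- Reduction mod q is a homomorphism (ℕ,+,*) → (ℤ_q,⊕,⊗); through it
  -- every ring law of ℤ_q is inherited from the corresponding law of ℕ.
  ⟦+⟧ : ∀ m n → ⟦ m ⟧ + ⟦ n ⟧ ≡ ⟦ m ℕ.+ n ⟧
  ⟦+⟧ m n = ⟦⟧-cong (begin
    (toℕ ⟦ m ⟧ ℕ.+ toℕ ⟦ n ⟧) % q ≡⟨ cong₂ (λ x y → (x ℕ.+ y) % q) (toℕ-⟦⟧ m) (toℕ-⟦⟧ n) ⟩
    (m % q ℕ.+ n % q) % q         ≡⟨ %-distribˡ-+ m n q ⟨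
    (m ℕ.+ n) % q                 ∎)

  ⟦*⟧ : ∀ m n → ⟦ m ⟧ * ⟦ n ⟧ ≡ ⟦ m ℕ.* n ⟧
  ⟦*⟧ m n = ⟦⟧-cong (begin
    (toℕ ⟦ m ⟧ ℕ.* toℕ ⟦ n ⟧) % q ≡⟨ cong₂ (λ x y → (x ℕ.* y) % q) (toℕ-⟦⟧ m) (toℕ-⟦⟧ n) ⟩
    (m % q ℕ.* (n % q)) % q       ≡⟨ %-distribˡ-* m n q ⟨
    (m ℕ.* n) % q                 ∎)

  +-reduceˡ : ∀ m b → ⟦ m ⟧ + b ≡ ⟦ m ℕ.+ toℕ b ⟧
  +-reduceˡ m b = trans (cong (⟦ m ⟧ +_) (sym (⟦toℕ⟧ b))) (⟦+⟧ m (toℕ b))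

  +-reduceʳ : ∀ a n → a + ⟦ n ⟧ ≡ ⟦ toℕ a ℕ.+ n ⟧
  +-reduceʳ a n = trans (cong (_+ ⟦ n ⟧) (sym (⟦toℕ⟧ a))) (⟦+⟧ (toℕ a) n)

  *-reduceˡ : ∀ m b → ⟦ m ⟧ * b ≡ ⟦ m ℕ.* toℕ b ⟧
  *-reduceˡ m b = trans (cong (⟦ m ⟧ *_) (sym (⟦toℕ⟧ b))) (⟦*⟧ m (toℕ b))

  *-reduceʳ : ∀ a n → a * ⟦ n ⟧ ≡ ⟦ toℕ a ℕ.* n ⟧
  *-reduceʳ a n = trans (cong (_* ⟦ n ⟧) (sym (⟦toℕ⟧ a))) (⟦*⟧ (toℕ a) n)

  +-comm : ∀ a b → a + b ≡ b + a
  +-comm a b = cong ⟦_⟧ (ℕₚ.+-comm (toℕ a) (toℕ b))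

  *-comm : ∀ a b → a * b ≡ b * a
  *-comm a b = cong ⟦_⟧ (ℕₚ.*-comm (toℕ a) (toℕ b))

  +-assoc : ∀ a b c → (a + b) + c ≡ a + (b + c)
  +-assoc a b c = begin
    (a + b) + c                            ≡⟨ +-reduceˡ _ c ⟩
    ⟦ (toℕ a ℕ.+ toℕ b) ℕ.+ toℕ c ⟧        ≡⟨ cong ⟦_⟧ (ℕₚ.+-assoc (toℕ a) _ _) ⟩
    ⟦ toℕ a ℕ.+ (toℕ b ℕ.+ toℕ c) ⟧        ≡⟨ +-reduceʳ a _ ⟨
    a + (b + c)                            ∎

  *-assoc : ∀ a b c → (a * b) * c ≡ a * (b * c)
  *-assoc a b c = begin
    (a * b) * c                            ≡⟨ *-reduceˡ _ c ⟩
    ⟦ (toℕ a ℕ.* toℕ b) ℕ.* toℕ c ⟧        ≡⟨ cong ⟦_⟧ (ℕₚ.*-assoc (toℕ a) _ _) ⟩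
    ⟦ toℕ a ℕ.* (toℕ b ℕ.* toℕ c) ⟧        ≡⟨ *-reduceʳ a _ ⟨
    a * (b * c)                            ∎

  *-distribˡ-+ : ∀ a b c → a * (b + c) ≡ a * b + a * c
  *-distribˡ-+ a b c = begin
    a * (b + c)                               ≡⟨ *-reduceʳ a _ ⟩
    ⟦ toℕ a ℕ.* (toℕ b ℕ.+ toℕ c) ⟧           ≡⟨ cong ⟦_⟧ (ℕₚ.*-distribˡ-+ (toℕ a) _ _) ⟩
    ⟦ toℕ a ℕ.* toℕ b ℕ.+ toℕ a ℕ.* toℕ c ⟧   ≡⟨ ⟦+⟧ _ _ ⟨
    a * b + a * c                             ∎

  +-identityˡ : ∀ a → 0q q + a ≡ a
  +-identityˡ a = trans (+-reduceˡ 0 a) (⟦toℕ⟧ a)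

  *-identityˡ : ∀ a → ⟦ 1 ⟧ * a ≡ a
  *-identityˡ a = trans (*-reduceˡ 1 a) (trans (cong ⟦_⟧ (ℕₚ.*-identityˡ (toℕ a))) (⟦toℕ⟧ a))

  -‿inverseˡ : ∀ a → (- a) + a ≡ 0q q
  -‿inverseˡ a = begin
    ⟦ q ℕ.∸ toℕ a ⟧ + a          ≡⟨ +-reduceˡ _ a ⟩
    ⟦ q ℕ.∸ toℕ a ℕ.+ toℕ a ⟧    ≡⟨ cong ⟦_⟧ (ℕₚ.m∸n+n≡m (ℕₚ.<⇒≤ (toℕ<n a))) ⟩
    ⟦ q ⟧                        ≡⟨ ⟦⟧-cong (trans (n%n≡0 q) (sym (ℕₚ.n≤0⇒n≡0 (m%n≤m 0 q)))) ⟩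
    ⟦ 0 ⟧                        ∎

  ℤq-commutativeRing : CommutativeRing 0ℓ 0ℓ
  ℤq-commutativeRing = record
    { Carrier = Zq q ; _≈_ = _≡_ ; _+_ = _+_ ; _*_ = _*_ ; -_ = -_ ; 0# = 0q q ; 1# = ⟦ 1 ⟧
    ; isCommutativeRing = record
      { isRing = record
        { +-isAbelianGroup = record
          { isGroup = record
            { isMonoid = record
              { isSemigroup = record
                { isMagma = record { isEquivalence = isEquivalence ; ∙-cong = cong₂ _+_ }
                ; assoc = +-assoc }
              ; identity = comm∧idˡ⇒id +-comm +-identityˡ }
            ; inverse = comm∧invˡ⇒inv +-comm -‿inverseˡ
            ; ⁻¹-cong = cong -_ }
          ; comm = +-comm }
        ; *-cong = cong₂ _*_
        ; *-assoc = *-assoc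
        ; *-identity = comm∧idˡ⇒id *-comm *-identityˡ
        ; distrib = *-distribˡ-+ , comm∧distrˡ⇒distrʳ *-comm *-distribˡ-+ }
      ; *-comm = *-comm } }


module LinearAlgebra (q : ℕ) .{{_ : NonZero q}} where

  open import Data.Nat using (zero; suc)
  open import Data.Fin using (Fin; zero; suc)
  open import Relation.Binary.PropositionalEquality
  open IntegersModulo q using (ℤq-commutativeRing)
  open CommutativeRing ℤq-commutativeRing
    using (_+_; _*_; -_; 0#; 1#; -‿inverseʳ; +-identityˡ; +-identityʳ; *-identityˡ; *-comm; *-assoc; zeroˡ; distribʳ; semiring)
  open import Algebra.Properties.Group (CommutativeRing.+-group ℤq-commutativeRing)
    using (inverseʳ-unique; ∙-cancelʳ)
  open import Algebra.Properties.Semiring.Sum semiring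
    using (sum; sum-cong-≗; ∑-distrib-+; ∑-comm; *-distribˡ-sum; *-distribʳ-sum; sum-replicate-zero)
  open ≡-Reasoning

  sumZ≡sum : ∀ m (f : Fin m → Zq q) → sumZ q m f ≡ sum f
  sumZ≡sum zero    f = refl
  sumZ≡sum (suc m) f = cong (f zero +_) (sumZ≡sum m (λ i → f (suc i)))

  dot≡sum : ∀ n (u x : V q n) → dot q n u x ≡ sum (λ i → u i * x i)
  dot≡sum n u x = sumZ≡sum n _

  _ᵀ : ∀ {n} → Mat q n → Mat q n
  (A ᵀ) i j = A j i

  unit : ∀ {n} → Fin n → V q n
  unit zero    zero    = 1#
  unit zero    (suc j) = 0#
  unit (suc i) zero    = 0#
  unit (suc i) (suc j) = unit i j

  dot-by-terms : ∀ n (u x u' x' : V q n) → (∀ i → u i * x i ≡ u' i * x' i) →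
                 dot q n u x ≡ dot q n u' x'
  dot-by-terms n u x u' x' e = begin
    dot q n u x                ≡⟨ dot≡sum n u x ⟩
    sum (λ i → u i * x i)      ≡⟨ sum-cong-≗ e ⟩
    sum (λ i → u' i * x' i)    ≡⟨ dot≡sum n u' x' ⟨
    dot q n u' x'              ∎

  dot-cong : ∀ n {u u' x x' : V q n} → u ≗ u' → x ≗ x' → dot q n u x ≡ dot q n u' x'
  dot-cong n {u} {u'} {x} {x'} u≗u' x≗x' = dot-by-terms n u x u' x' (λ i → cong₂ _*_ (u≗u' i) (x≗x' i))

  matVec-cong : ∀ n (A : Mat q n) {x x' : V q n} → x ≗ x' → matVec q n A x ≗ matVec q n A x'
  matVec-cong n A x≗x' i = dot-cong n {u = A i} (λ _ → refl) x≗x'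

  dot-comm : ∀ n (u x : V q n) → dot q n u x ≡ dot q n x u
  dot-comm n u x = dot-by-terms n u x x u (λ i → *-comm (u i) (x i))

  dot-+ˡ : ∀ n (u w x : V q n) → dot q n (_+V_ q u w) x ≡ dot q n u x + dot q n w x
  dot-+ˡ n u w x = begin
    dot q n (_+V_ q u w) x                            ≡⟨ dot≡sum n (_+V_ q u w) x ⟩
    sum (λ i → (u i + w i) * x i)                     ≡⟨ sum-cong-≗ (λ i → distribʳ (x i) (u i) (w i)) ⟩
    sum (λ i → u i * x i + w i * x i)                 ≡⟨ ∑-distrib-+ (λ i → u i * x i) (λ i → w i * x i) ⟩
    sum (λ i → u i * x i) + sum (λ i → w i * x i)     ≡⟨ cong₂ _+_ (dot≡sum n u x) (dot≡sum n w x) ⟨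
    dot q n u x + dot q n w x                         ∎

  dot-+ʳ : ∀ n (v x y : V q n) → dot q n v (_+V_ q x y) ≡ dot q n v x + dot q n v y
  dot-+ʳ n v x y = begin
    dot q n v (_+V_ q x y)     ≡⟨ dot-comm n v _ ⟩
    dot q n (_+V_ q x y) v     ≡⟨ dot-+ˡ n x y v ⟩
    dot q n x v + dot q n y v  ≡⟨ cong₂ _+_ (dot-comm n x v) (dot-comm n y v) ⟩
    dot q n v x + dot q n v y  ∎

  dot-adjoint : ∀ n (A : Mat q n) (u x : V q n) →
                dot q n (matVec q n A u) x ≡ dot q n u (matVec q n (A ᵀ) x)
  dot-adjoint n A u x = begin
    dot q n (matVec q n A u) x                  ≡⟨ dot-by-terms n (matVec q n A u) x (λ i → sum (λ j → A i j * u j)) x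
                                                                 (λ i → cong (_* x i) (dot≡sum n (A i) u)) ⟩
    dot q n (λ i → sum (λ j → A i j * u j)) x   ≡⟨ dot≡sum n (λ i → sum (λ j → A i j * u j)) x ⟩
    sum (λ i → sum (λ j → A i j * u j) * x i)   ≡⟨ sum-cong-≗ (λ i → *-distribʳ-sum (x i) (λ j → A i j * u j)) ⟩
    sum (λ i → sum (λ j → A i j * u j * x i))   ≡⟨ ∑-comm (λ i j → A i j * u j * x i) ⟩
    sum (λ j → sum (λ i → A i j * u j * x i))   ≡⟨ sum-cong-≗ (λ j → sum-cong-≗ (λ i → rearrange (A i j) (u j) (x i))) ⟩
    sum (λ j → sum (λ i → u j * (A i j * x i))) ≡⟨ sum-cong-≗ (λ j → *-distribˡ-sum (u j) (λ i → A i j * x i)) ⟨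
    sum (λ j → u j * sum (λ i → A i j * x i))   ≡⟨ dot≡sum n u _ ⟨
    dot q n u (λ j → sum (λ i → A i j * x i))   ≡⟨ dot-by-terms n u (matVec q n (A ᵀ) x) u (λ j → sum (λ i → A i j * x i))
                                                                 (λ j → cong (u j *_) (dot≡sum n (λ i → A i j) x)) ⟨
    dot q n u (matVec q n (A ᵀ) x)              ∎
    where
    rearrange : ∀ a b c → a * b * c ≡ b * (a * c)
    rearrange a b c = trans (cong (_* c) (*-comm a b)) (*-assoc b a c)

  dot-zeroˡ : ∀ n (y : V q n) → dot q n (λ _ → 0#) y ≡ 0#
  dot-zeroˡ n y = begin
    dot q n (λ _ → 0#) y       ≡⟨ dot≡sum n (λ _ → 0#) y ⟩
    sum (λ j → 0# * y j)       ≡⟨ sum-cong-≗ (λ j → zeroˡ (y j)) ⟩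
    sum {n} (λ _ → 0#)         ≡⟨ sum-replicate-zero n ⟩
    0#                         ∎

  dot-zeroʳ : ∀ n (v : V q n) → dot q n v (λ _ → 0#) ≡ 0#
  dot-zeroʳ n v = trans (dot-comm n v (λ _ → 0#)) (dot-zeroˡ n v)

  dot-unit : ∀ n (i : Fin n) (x : V q n) → dot q n (unit i) x ≡ x i
  dot-unit (suc n) zero x = begin
    1# * x zero + dot q n (λ _ → 0#) (λ j → x (suc j))  ≡⟨ cong₂ _+_ (*-identityˡ (x zero)) (dot-zeroˡ n (λ j → x (suc j))) ⟩
    x zero + 0#                                          ≡⟨ +-identityʳ (x zero) ⟩
    x zero                                               ∎
  dot-unit (suc n) (suc i) x = begin
    0# * x zero + dot q n (unit i) (λ j → x (suc j))     ≡⟨ cong₂ _+_ (zeroˡ (x zero)) (dot-unit n i (λ j → x (suc j))) ⟩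
    0# + x (suc i)                                       ≡⟨ +-identityˡ (x (suc i)) ⟩
    x (suc i)                                            ∎

  dot-negʳ : ∀ n (v c : V q n) → dot q n v (λ i → - c i) ≡ - dot q n c v
  dot-negʳ n v c = inverseʳ-unique (dot q n c v) (dot q n v (λ i → - c i)) (begin
    dot q n c v + dot q n v (λ i → - c i)    ≡⟨ cong (_+ dot q n v (λ i → - c i)) (dot-comm n c v) ⟩
    dot q n v c + dot q n v (λ i → - c i)    ≡⟨ dot-+ʳ n v c (λ i → - c i) ⟨
    dot q n v (λ i → c i + - c i)            ≡⟨ dot-cong n {v} (λ _ → refl) (λ i → -‿inverseʳ (c i)) ⟩
    dot q n v (λ _ → 0#)                     ≡⟨ dot-zeroʳ n v ⟩
    0#                                       ∎)

  rowsOf : ∀ {n} → (V q n → V q n) → Mat q n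
  rowsOf p i = p (unit i)

  -- If the linear map x ↦ A x has a right inverse p (as a function), then
  -- rowsOf p is a left inverse of Aᵀ, since p(eᵢ)·(Aᵀ x) = (A p(eᵢ))·x = eᵢ·x = xᵢ.
  transpose-leftInverse : ∀ n (A : Mat q n) (p : V q n → V q n) →
                          (∀ y → matVec q n A (p y) ≗ y) →
                          ∀ x → matVec q n (rowsOf p) (matVec q n (A ᵀ) x) ≗ x
  transpose-leftInverse n A p Ap≗id x i = begin
    dot q n (p (unit i)) (matVec q n (A ᵀ) x) ≡⟨ dot-adjoint n A (p (unit i)) x ⟨
    dot q n (matVec q n A (p (unit i))) x     ≡⟨ dot-cong n (Ap≗id (unit i)) (λ _ → refl) ⟩
    dot q n (unit i) x                        ≡⟨ dot-unit n i x ⟩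
    x i                                       ∎

  linearPart-rightInverse : ∀ n (T T' : V q n → V q n) (A : Mat q n) (b : V q n) →
                            (∀ x i → T x i ≡ (_+V_ q (matVec q n A x) b) i) →
                            (∀ y i → T (T' y) i ≡ y i) →
                            ∀ y → matVec q n A (T' (_+V_ q y b)) ≗ y
  linearPart-rightInverse n T T' A b T≗ TT'≗ y i =
    ∙-cancelʳ (b i) _ (y i) (trans (sym (T≗ (T' (_+V_ q y b)) i)) (TT'≗ (_+V_ q y b) i))


module Enumeration {A : Set} where

  open import Data.Nat using (suc; _≤_)
  open import Data.Nat.Properties using (≤-pred; ≤-trans; ≤-reflexive; +-suc)
  open import Data.List using (List; []; _∷_; _++_; map; length)
  open import Data.List.Properties using (length-++; length-map)
  open import Data.List.Membership.Propositional using (_∈_)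
  open import Data.List.Relation.Binary.Subset.Propositional using (_⊆_)
  open import Data.List.Membership.Propositional.Properties using (∈-∃++; ∈-++⁻; ∈-++⁺ˡ; ∈-++⁺ʳ)
  open import Data.List.Membership.Propositional.Properties.WithK using (unique∧set⇒bag)
  open import Data.List.Relation.Unary.Any using (here; there)
  import Data.List.Relation.Unary.All as All
  open import Data.List.Relation.Unary.AllPairs using (_∷_)
  open import Data.List.Relation.Unary.Unique.Propositional using (Unique)
  open import Data.List.Relation.Unary.Unique.Propositional.Properties using (map⁺)
  open import Data.List.Relation.Binary.Permutation.Propositional using (_↭_)
  open import Data.List.Relation.Binary.BagAndSetEquality using (∼bag⇒↭)
  open import Data.Sum using (_⊎_; inj₁; inj₂; [_,_]′)
  open import Function using (_∘_; id)
  open import Data.Empty using (⊥-elim)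
  open import Function.Bundles using (mk⇔)
  open import Relation.Binary.PropositionalEquality using (_≡_; refl; sym; trans; cong)

  ∈-cut : ∀ (as bs : List A) {x z : A} → z ∈ as ++ x ∷ bs → z ≡ x ⊎ z ∈ as ++ bs
  ∈-cut as bs z∈ with ∈-++⁻ as z∈
  ... | inj₁ z∈as         = inj₂ (∈-++⁺ˡ z∈as)
  ... | inj₂ (here z≡x)   = inj₁ z≡x
  ... | inj₂ (there z∈bs) = inj₂ (∈-++⁺ʳ as z∈bs)

  length-cut : ∀ (as bs : List A) (x : A) → length (as ++ x ∷ bs) ≡ suc (length (as ++ bs))
  length-cut as bs x = trans (length-++ as) (trans (+-suc (length as) (length bs)) (cong suc (sym (length-++ as))))

  pigeonhole : ∀ xs ys → Unique xs → xs ⊆ ys → length ys ≤ length xs → ys ⊆ xs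
  pigeonhole []       []       _             _     _     ()
  pigeonhole (x ∷ xs) ys (x∉xs ∷ uxs) xs⊆ys |ys|≤ with ∈-∃++ (xs⊆ys (here refl))
  ... | as , bs , refl = λ z∈ys → [ here , there ∘ ys'⊆xs ]′ (∈-cut as bs z∈ys)
    where
    xs⊆ys' : xs ⊆ (as ++ bs)
    xs⊆ys' w∈xs = [ (λ w≡x → ⊥-elim (All.lookup x∉xs w∈xs (sym w≡x))) , id ]′
                    (∈-cut as bs (xs⊆ys (there w∈xs)))
    ys'⊆xs : (as ++ bs) ⊆ xs
    ys'⊆xs = pigeonhole xs (as ++ bs) uxs xs⊆ys'
               (≤-pred (≤-trans (≤-reflexive (sym (length-cut as bs x))) |ys|≤))

  injection-permutes : ∀ xs (σ : A → A) → (∀ {x y} → σ x ≡ σ y → x ≡ y) →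
                       Unique xs → (∀ z → z ∈ xs) → map σ xs ↭ xs
  injection-permutes xs σ σ-inj uxs complete =
    ∼bag⇒↭ (unique∧set⇒bag uσxs uxs (mk⇔ (λ _ → complete _) σxs⊇xs))
    where
    uσxs : Unique (map σ xs)
    uσxs = map⁺ σ-inj uxs
    σxs⊇xs : xs ⊆ map σ xs
    σxs⊇xs = pigeonhole (map σ xs) xs uσxs (λ _ → complete _) (≤-reflexive (sym (length-map σ xs)))


module CharacterSums {c ℓ : Level} (R : CommutativeRing c ℓ) (q : ℕ) .{{_ : NonZero q}}
         (ζ : CommutativeRing.Carrier R) (ζ^q≈1 : CommutativeRing._≈_ R (pow R ζ q) (CommutativeRing.1# R)) where

  open CommutativeRing R
  open import Algebra.Properties.Semiring.Exp semiring using (_^_; ^-homo-*)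
  open import Data.Nat as ℕ using (zero; suc)
  open import Data.Nat.DivMod using (_%_; _/_; m%n<n; m≡m%n+[m/n]*n)
  open import Data.Fin as Fin using (Fin; toℕ)
  open import Data.Fin.Properties using (toℕ-fromℕ<)
  open import Data.Vec using (Vec; []; _∷_; tabulate; lookup)
  open import Data.Vec.Properties using (∷-injective; tabulate-cong; lookup∘tabulate)
  import Data.Vec.Functional as Vector
  open import Data.List as List using (List; [_]; _++_; map; allFin; cartesianProductWith)
  open import Data.List.Membership.Propositional using (_∈_)
  open import Data.List.Membership.Propositional.Properties using (∈-cartesianProductWith⁺; ∈-allFin)
  open import Data.List.Relation.Unary.Any using (here)
  open import Data.List.Relation.Unary.AllPairs using ([]; _∷_)
  open import Data.List.Relation.Unary.All using ([])
  open import Data.List.Relation.Unary.Unique.Propositional using (Unique)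
  open import Data.List.Relation.Unary.Unique.Propositional.Properties using (cartesianProductWith⁺; allFin⁺)
  open import Data.List.Relation.Binary.Permutation.Propositional as Perm using (_↭_)
  open import Relation.Binary.PropositionalEquality as ≡ using (_≡_; _≗_)
  open import Relation.Binary.Reasoning.Setoid setoid

  private
    χ' : Zq q → Carrier
    χ' = χ R q ζ

  -- The character χ(a) = ζ^a is additive, because ζ has order dividing q.
  pow≡^ : ∀ x k → pow R x k ≡ x ^ k
  pow≡^ x zero    = ≡.refl
  pow≡^ x (suc k) = ≡.cong (x *_) (pow≡^ x k)

  ζ^kq≈1 : ∀ k → ζ ^ (k ℕ.* q) ≈ 1#
  ζ^kq≈1 zero    = refl
  ζ^kq≈1 (suc k) = begin
    ζ ^ (q ℕ.+ k ℕ.* q)        ≈⟨ ^-homo-* ζ q (k ℕ.* q) ⟩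
    ζ ^ q * ζ ^ (k ℕ.* q)      ≈⟨ *-cong (trans (reflexive (≡.sym (pow≡^ ζ q))) ζ^q≈1) (ζ^kq≈1 k) ⟩
    1# * 1#                    ≈⟨ *-identityˡ 1# ⟩
    1#                         ∎

  ζ^-mod : ∀ m → ζ ^ (m % q) ≈ ζ ^ m
  ζ^-mod m = sym (begin
    ζ ^ m                                 ≡⟨ ≡.cong (ζ ^_) (m≡m%n+[m/n]*n m q) ⟩
    ζ ^ (m % q ℕ.+ (m / q) ℕ.* q)         ≈⟨ ^-homo-* ζ (m % q) _ ⟩
    ζ ^ (m % q) * ζ ^ ((m / q) ℕ.* q)     ≈⟨ *-congˡ (ζ^kq≈1 (m / q)) ⟩
    ζ ^ (m % q) * 1#                      ≈⟨ *-identityʳ _ ⟩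
    ζ ^ (m % q)                           ∎)

  χ-⊕ : ∀ a b → χ' (_⊕_ q a b) ≈ χ' a * χ' b
  χ-⊕ a b = begin
    pow R ζ (toℕ (_⊕_ q a b))      ≡⟨ pow≡^ ζ (toℕ (_⊕_ q a b)) ⟩
    ζ ^ toℕ (_⊕_ q a b)            ≡⟨ ≡.cong (ζ ^_) (toℕ-fromℕ< (m%n<n (toℕ a ℕ.+ toℕ b) q)) ⟩
    ζ ^ ((toℕ a ℕ.+ toℕ b) % q)    ≈⟨ ζ^-mod _ ⟩
    ζ ^ (toℕ a ℕ.+ toℕ b)          ≈⟨ ^-homo-* ζ (toℕ a) (toℕ b) ⟩
    ζ ^ toℕ a * ζ ^ toℕ b          ≡⟨ ≡.cong₂ _*_ (pow≡^ ζ (toℕ a)) (pow≡^ ζ (toℕ b)) ⟨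
    χ' a * χ' b                    ∎

  -- Functions Fin n → ℤ_q
  -- are compared pointwise (_≗_), and the integrand of a Walsh–Hadamard
  -- sum need not respect _≗_; sums only ever evaluate it at the points
  -- fromVec w, which are determined by the list of coordinates w.
  fromVec : ∀ {n} → Vec (Zq q) n → V q n
  fromVec []      = λ ()
  fromVec (a ∷ w) = a Vector.∷ fromVec w

  canon : ∀ {n} → V q n → V q n
  canon x = fromVec (tabulate x)

  canon-≗ : ∀ {n} (x : V q n) → canon x ≗ x
  canon-≗ x Fin.zero    = ≡.refl
  canon-≗ x (Fin.suc i) = canon-≗ (λ j → x (Fin.suc j)) i

  tabulate-fromVec : ∀ {n} (w : Vec (Zq q) n) → tabulate (fromVec w) ≡ w
  tabulate-fromVec []      = ≡.refl
  tabulate-fromVec (a ∷ w) = ≡.cong (a ∷_) (tabulate-fromVec w)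

  tabulate-injective : ∀ {n} {x y : V q n} → tabulate x ≡ tabulate y → x ≗ y
  tabulate-injective {x = x} {y} e i =
    ≡.trans (≡.sym (lookup∘tabulate x i)) (≡.trans (≡.cong (λ w → lookup w i) e) (lookup∘tabulate y i))

  canon-unique : ∀ {n} {y : V q n} (w : Vec (Zq q) n) → y ≗ fromVec w → canon y ≡ fromVec w
  canon-unique w y≗w = ≡.cong fromVec (≡.trans (tabulate-cong y≗w) (tabulate-fromVec w))

  allVec : ∀ n → List (Vec (Zq q) n)
  allVec zero    = [ [] ]
  allVec (suc n) = cartesianProductWith _∷_ (allFin q) (allVec n)

  allVec-unique : ∀ n → Unique (allVec n)
  allVec-unique zero    = [] ∷ []
  allVec-unique (suc n) = cartesianProductWith⁺ _∷_ ∷-injective (allFin⁺ q) (allVec-unique n)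

  allVec-complete : ∀ n (w : Vec (Zq q) n) → w ∈ allVec n
  allVec-complete zero    []      = here ≡.refl
  allVec-complete (suc n) (a ∷ w) = ∈-cartesianProductWith⁺ _∷_ (∈-allFin a) (allVec-complete n w)

  listSum : {A : Set} → (A → Carrier) → List A → Carrier
  listSum f List.[]       = 0#
  listSum f (x List.∷ xs) = f x + listSum f xs

  listSum-cong : {A : Set} {f g : A → Carrier} (xs : List A) → (∀ x → f x ≈ g x) → listSum f xs ≈ listSum g xs
  listSum-cong List.[]       f≈g = refl
  listSum-cong (x List.∷ xs) f≈g = +-cong (f≈g x) (listSum-cong xs f≈g)

  listSum-++ : {A : Set} (f : A → Carrier) (xs ys : List A) → listSum f (xs ++ ys) ≈ listSum f xs + listSum f ys
  listSum-++ f List.[]       ys = sym (+-identityˡ _)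
  listSum-++ f (x List.∷ xs) ys = trans (+-congˡ (listSum-++ f xs ys)) (sym (+-assoc _ _ _))

  listSum-map : {A B : Set} (f : B → Carrier) (g : A → B) (xs : List A) → listSum f (map g xs) ≡ listSum (λ x → f (g x)) xs
  listSum-map f g List.[]       = ≡.refl
  listSum-map f g (x List.∷ xs) = ≡.cong (f (g x) +_) (listSum-map f g xs)

  listSum-*ˡ : {A : Set} (a : Carrier) (f : A → Carrier) (xs : List A) → a * listSum f xs ≈ listSum (λ x → a * f x) xs
  listSum-*ˡ a f List.[]       = zeroʳ a
  listSum-*ˡ a f (x List.∷ xs) = trans (distribˡ _ _ _) (+-congˡ (listSum-*ˡ a f xs))

  listSum-↭ : {A : Set} (f : A → Carrier) {xs ys : List A} → xs ↭ ys → listSum f xs ≈ listSum f ys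
  listSum-↭ f Perm.refl          = refl
  listSum-↭ f (Perm.prep x p)    = +-congˡ (listSum-↭ f p)
  listSum-↭ f (Perm.swap x y p)  =
    trans (sym (+-assoc _ _ _)) (trans (+-congʳ (+-comm _ _)) (trans (+-assoc _ _ _) (+-congˡ (+-congˡ (listSum-↭ f p)))))
  listSum-↭ f (Perm.trans p p′)  = trans (listSum-↭ f p) (listSum-↭ f p′)

  listSum-tabulate : ∀ m {B : Set} (g : Fin m → B) (h : B → Carrier) → listSum h (List.tabulate g) ≈ sumFin R q ζ m (λ i → h (g i))
  listSum-tabulate zero    g h = refl
  listSum-tabulate (suc m) g h = +-congˡ (listSum-tabulate m (λ i → g (Fin.suc i)) h)

  listSum-cartesian : {A B C : Set} (G : C → Carrier) (f : A → B → C) (xs : List A) (ys : List B) →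
                      listSum G (cartesianProductWith f xs ys) ≈ listSum (λ a → listSum (λ b → G (f a b)) ys) xs
  listSum-cartesian G f List.[]       ys = refl
  listSum-cartesian G f (x List.∷ xs) ys =
    trans (listSum-++ G (map (f x) ys) _) (+-cong (reflexive (listSum-map G (f x) ys)) (listSum-cartesian G f xs ys))

  sumV-as-listSum : ∀ n (F : V q n → Carrier) → sumV R q ζ n F ≈ listSum (λ w → F (fromVec w)) (allVec n)
  sumV-as-listSum zero    F = sym (+-identityʳ _)
  sumV-as-listSum (suc n) F = begin
    sumFin R q ζ q (λ a → sumV R q ζ n (λ x → F (a Vector.∷ x)))               ≈⟨ sumFin-cong q (λ a →
                                                                                  sumV-as-listSum n (λ x → F (a Vector.∷ x))) ⟩
    sumFin R q ζ q (λ a → listSum (λ w → F (a Vector.∷ fromVec w)) (allVec n)) ≈⟨ listSum-tabulate q (λ a → a) _ ⟨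
    listSum (λ a → listSum (λ w → F (fromVec (a ∷ w))) (allVec n)) (allFin q)  ≈⟨ listSum-cartesian (λ w → F (fromVec w))
                                                                                                     _∷_ (allFin q) (allVec n) ⟨
    listSum (λ w → F (fromVec w)) (allVec (suc n))                             ∎
    where
    sumFin-cong : ∀ m {f g : Fin m → Carrier} → (∀ i → f i ≈ g i) → sumFin R q ζ m f ≈ sumFin R q ζ m g
    sumFin-cong zero    f≈g = refl
    sumFin-cong (suc m) f≈g = +-cong (f≈g Fin.zero) (sumFin-cong m (λ i → f≈g (Fin.suc i)))

  sumV-cong : ∀ n {F G : V q n → Carrier} → (∀ w → F (fromVec w) ≈ G (fromVec w)) → sumV R q ζ n F ≈ sumV R q ζ n G
  sumV-cong n {F} {G} F≈G = begin
    sumV R q ζ n F                           ≈⟨ sumV-as-listSum n F ⟩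
    listSum (λ w → F (fromVec w)) (allVec n) ≈⟨ listSum-cong (allVec n) F≈G ⟩
    listSum (λ w → G (fromVec w)) (allVec n) ≈⟨ sumV-as-listSum n G ⟨
    sumV R q ζ n G                           ∎

  sumV-*ˡ : ∀ n (a : Carrier) (F : V q n → Carrier) → a * sumV R q ζ n F ≈ sumV R q ζ n (λ x → a * F x)
  sumV-*ˡ n a F = begin
    a * sumV R q ζ n F                               ≈⟨ *-congˡ (sumV-as-listSum n F) ⟩
    a * listSum (λ w → F (fromVec w)) (allVec n)     ≈⟨ listSum-*ˡ a _ (allVec n) ⟩
    listSum (λ w → a * F (fromVec w)) (allVec n)     ≈⟨ sumV-as-listSum n (λ x → a * F x) ⟨
    sumV R q ζ n (λ x → a * F x)                     ∎

  -- Change of variables: a map of V_n which is injective (up to pointwise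
  -- equality) is a bijection, so precomposing with it preserves sums.
  sumV-reindex : ∀ n (σ : V q n → V q n) → (∀ {x y} → σ x ≗ σ y → x ≗ y) →
                 (F : V q n → Carrier) → sumV R q ζ n (λ x → F (canon (σ x))) ≈ sumV R q ζ n F
  sumV-reindex n σ σ-inj F = begin
    sumV R q ζ n (λ x → F (canon (σ x)))                ≈⟨ sumV-as-listSum n _ ⟩
    listSum (λ w → F (fromVec (σ̂ w))) (allVec n)         ≡⟨ listSum-map (λ w → F (fromVec w)) σ̂ (allVec n) ⟨
    listSum (λ w → F (fromVec w)) (map σ̂ (allVec n))     ≈⟨ listSum-↭ _ σ̂-permutes ⟩
    listSum (λ w → F (fromVec w)) (allVec n)             ≈⟨ sumV-as-listSum n F ⟨
    sumV R q ζ n F                                       ∎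
    where
    open Enumeration using (injection-permutes)
    σ̂ : Vec (Zq q) n → Vec (Zq q) n
    σ̂ w = tabulate (σ (fromVec w))
    σ̂-inj : ∀ {w w'} → σ̂ w ≡ σ̂ w' → w ≡ w'
    σ̂-inj {w} {w'} e =
      ≡.trans (≡.sym (tabulate-fromVec w))
        (≡.trans (tabulate-cong (σ-inj (tabulate-injective e))) (tabulate-fromVec w'))
    σ̂-permutes : map σ̂ (allVec n) ↭ allVec n
    σ̂-permutes = injection-permutes (allVec n) σ̂ σ̂-inj (allVec-unique n) (allVec-complete n)


module Twist {c ℓ : Level} (R : CommutativeRing c ℓ) (q : ℕ) .{{_ : NonZero q}}
         (ζ : CommutativeRing.Carrier R) (ζ^q≈1 : CommutativeRing._≈_ R (pow R ζ q) (CommutativeRing.1# R))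
         (n : ℕ) where

  open import Data.Product using (Σ)
  open import Relation.Binary.PropositionalEquality as ≡ using (_≡_; _≗_)
  open CommutativeRing R using (Carrier; _≈_; _*_; *-congˡ; setoid)
  open IntegersModulo q using (ℤq-commutativeRing)
  open CommutativeRing ℤq-commutativeRing using (+-commutativeMonoid; +-abelianGroup; +-assoc; -‿inverseˡ; +-identityʳ)
    renaming (_+_ to _+q_; -_ to -q_)
  open import Algebra.Properties.AbelianGroup +-abelianGroup using (⁻¹-∙-comm; ⁻¹-involutive)
  open import Algebra.Solver.CommutativeMonoid +-commutativeMonoid using (solve; _⊜_) renaming (_⊕_ to _⊞_)
  open LinearAlgebra q
  open CharacterSums R q ζ ζ^q≈1

  private
    _·_ : V q n → V q n → Zq q
    u · x = dot q n u x
    _⊞ᵥ_ : V q n → V q n → V q n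
    _⊞ᵥ_ = _+V_ q
    χ' : Zq q → Carrier
    χ' = χ R q ζ
    infixl 6 _⊞ᵥ_

  -- The exponent bookkeeping behind the change of variables, with
  -- C = c·v, G = g(x), P = v·(Aᵀx), Q = b·x.
  exponent-identity : ∀ C d G P Q → (C +q d) +q (G +q -q (P +q Q)) ≡ ((G +q d) +q -q Q) +q -q (P +q -q C)
  exponent-identity C d G P Q = begin
    (C +q d) +q (G +q -q (P +q Q))           ≡⟨ ≡.cong (λ t → (C +q d) +q (G +q t)) (⁻¹-∙-comm P Q) ⟨
    (C +q d) +q (G +q (-q P +q -q Q))        ≡⟨ solve 5 (λ C d G P Q → (C ⊞ d) ⊞ (G ⊞ (P ⊞ Q)) ⊜ ((G ⊞ d) ⊞ Q) ⊞ (P ⊞ C))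
                                                       ≡.refl C d G (-q P) (-q Q) ⟩
    ((G +q d) +q -q Q) +q (-q P +q C)        ≡⟨ ≡.cong (λ t → ((G +q d) +q -q Q) +q (-q P +q t)) (⁻¹-involutive C) ⟨
    ((G +q d) +q -q Q) +q (-q P +q -q -q C)  ≡⟨ ≡.cong (((G +q d) +q -q Q) +q_) (⁻¹-∙-comm P (-q C)) ⟩
    ((G +q d) +q -q Q) +q -q (P +q -q C)     ∎
    where open ≡.≡-Reasoning

  -- The change of variables of the twist lemma: for T x = A x + b with a
  -- right inverse T', the map σ(x) = Aᵀx − c has the left inverse τ built
  -- by transpose-leftInverse, so σ is injective; ρ picks canonical
  -- preimages under σ.
  module Substitution (T T' : V q n → V q n) (A : Mat q n) (b c : V q n)
                      (T≗ : ∀ x i → T x i ≡ (matVec q n A x ⊞ᵥ b) i)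
                      (TT'≗ : ∀ y i → T (T' y) i ≡ y i) where

    -- the left inverse of Aᵀ: its rows are T'(eᵢ + b)
    B : Mat q n
    B = rowsOf (λ y → T' (y ⊞ᵥ b))

    σ τ : V q n → V q n
    σ x = matVec q n (A ᵀ) x ⊞ᵥ (λ i → -q c i)
    τ y = matVec q n B (y ⊞ᵥ c)

    τ-cong : ∀ {y y'} → y ≗ y' → τ y ≗ τ y'
    τ-cong y≗y' = matVec-cong n B (λ j → ≡.cong (_+q c j) (y≗y' j))

    τσ≗id : ∀ x → τ (σ x) ≗ x
    τσ≗id x i = ≡.trans (matVec-cong n B cancel-c i)
                  (transpose-leftInverse n A _ (linearPart-rightInverse n T T' A b T≗ TT'≗) x i)
      where
      cancel-c : σ x ⊞ᵥ c ≗ matVec q n (A ᵀ) x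
      cancel-c j = ≡.trans (+-assoc _ (-q c j) (c j))
                     (≡.trans (≡.cong (matVec q n (A ᵀ) x j +q_) (-‿inverseˡ (c j))) (+-identityʳ _))

    σ-injective : ∀ {x y} → σ x ≗ σ y → x ≗ y
    σ-injective {x} {y} σx≗σy i = ≡.trans (≡.sym (τσ≗id x i)) (≡.trans (τ-cong σx≗σy i) (τσ≗id y i))

    ρ : V q n → V q n
    ρ y = canon (τ y)

    ρσ : ∀ w → ρ (canon (σ (fromVec w))) ≡ fromVec w
    ρσ w = canon-unique w (λ i → ≡.trans (τ-cong (canon-≗ (σ (fromVec w))) i) (τσ≗id (fromVec w) i))

  -- Writing T v = A v + b and ψ v = c·v + d, the substitution
  -- y = σ(x) = Aᵀx − c turns the sum defining the left side into ĥ(v) with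
  -- h(y) = g(x) + d − b·x.
  WHT-affine-twist : (T : V q n → V q n) → IsAffineMap q n T → IsInvertible q n T →
                     (ψ : V q n → Zq q) → IsAffineFunction q n ψ → (g : V q n → Zq q) →
                     Σ (V q n → Zq q) λ h → ∀ v → χ' (ψ v) * WHT R q ζ n g (T v) ≈ WHT R q ζ n h v
  WHT-affine-twist T (A , b , T≗) (T' , TT'≗ , _) ψ (c , d , ψ≡) g = h , twisted
    where
    open Substitution T T' A b c T≗ TT'≗

    h : V q n → Zq q
    h y = (g (ρ y) +q d) +q -q (b · ρ y)

    exponent : ∀ v w → let x = fromVec w ; y = canon (σ x) in
               ψ v +q (g x +q -q (T v · x)) ≡ h y +q -q (v · y)
    exponent v w = begin
      ψ v +q (g x +q -q (T v · x))                              ≡⟨ ≡.cong₂ (λ s t → s +q (g x +q -q t)) (ψ≡ v) Tv·x ⟩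
      (c · v +q d) +q (g x +q -q (v · Aᵀx +q b · x))            ≡⟨ exponent-identity (c · v) d (g x) (v · Aᵀx) (b · x) ⟩
      ((g x +q d) +q -q (b · x)) +q -q (v · Aᵀx +q -q (c · v))  ≡⟨ ≡.cong₂ (λ s t → s +q -q t) (≡.sym hy) (≡.sym v·y) ⟩
      h y +q -q (v · y)                                         ∎
      where
      open ≡.≡-Reasoning
      x y Aᵀx : V q n
      x = fromVec w
      y = canon (σ x)
      Aᵀx = matVec q n (A ᵀ) x
      Tv·x : T v · x ≡ v · Aᵀx +q b · x
      Tv·x = ≡.trans (dot-cong n (T≗ v) (λ _ → ≡.refl))
               (≡.trans (dot-+ˡ n (matVec q n A v) b x) (≡.cong (_+q b · x) (dot-adjoint n A v x)))
      hy : h y ≡ (g x +q d) +q -q (b · x)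
      hy = ≡.cong (λ z → (g z +q d) +q -q (b · z)) (ρσ w)
      v·y : v · y ≡ v · Aᵀx +q -q (c · v)
      v·y = ≡.trans (dot-cong n {v} (λ _ → ≡.refl) (canon-≗ (σ x)))
              (≡.trans (dot-+ʳ n v Aᵀx _) (≡.cong (v · Aᵀx +q_) (dot-negʳ n v c)))

    H : V q n → V q n → Carrier
    H v y = χ' (h y) * χ' (-q (v · y))

    term : ∀ v w → let x = fromVec w in
           χ' (ψ v) * (χ' (g x) * χ' (-q (T v · x))) ≈ H v (canon (σ x))
    term v w = begin
      χ' (ψ v) * (χ' (g x) * χ' (-q (T v · x)))  ≈⟨ *-congˡ (χ-⊕ (g x) _) ⟨
      χ' (ψ v) * χ' (g x +q -q (T v · x))        ≈⟨ χ-⊕ (ψ v) _ ⟨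
      χ' (ψ v +q (g x +q -q (T v · x)))          ≡⟨ ≡.cong χ' (exponent v w) ⟩
      χ' (h y +q -q (v · y))                     ≈⟨ χ-⊕ (h y) _ ⟩
      H v y                                      ∎
      where
      open import Relation.Binary.Reasoning.Setoid setoid
      x y : V q n
      x = fromVec w
      y = canon (σ x)

    twisted : ∀ v → χ' (ψ v) * WHT R q ζ n g (T v) ≈ WHT R q ζ n h v
    twisted v = begin
      χ' (ψ v) * WHT R q ζ n g (T v)                                ≈⟨ sumV-*ˡ n (χ' (ψ v)) _ ⟩
      sumV R q ζ n (λ x → χ' (ψ v) * (χ' (g x) * χ' (-q (T v · x)))) ≈⟨ sumV-cong n (term v) ⟩
      sumV R q ζ n (λ x → H v (canon (σ x)))                        ≈⟨ sumV-reindex n σ σ-injective (H v) ⟩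
      WHT R q ζ n h v                                               ∎
      where open import Relation.Binary.Reasoning.Setoid setoid


proposition3 : {c ℓ : Level} (R : CommutativeRing c ℓ) (q : ℕ) .{{_ : NonZero q}} → 2 ≤ q →
    (ζ : CommutativeRing.Carrier R) →
    CommutativeRing._≈_ R (pow R ζ q) (CommutativeRing.1# R) →
    (n : ℕ) (π : V q n → V q n → V q n) → Biaffine q n π → Nonsingular q n π →
    (g : V q n → Zq q) (φ : V q n → V q n → Zq q) → BiaffineFunction q n φ →
    BentSquare R q ζ n
      (λ u v → CommutativeRing._*_ R (χ R q ζ (φ u v)) (WHT R q ζ n g (π u v)))
proposition3 R q _ ζ ζ^q≈1 n π (π-affine-in-u , π-affine-in-v) (π-invertible-in-u , π-invertible-in-v)
             g φ (φ-affine-in-u , φ-affine-in-v) =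
    (λ u → WHT-affine-twist (λ v → π u v) (π-affine-in-v u) (π-invertible-in-v u)
                            (λ v → φ u v) (φ-affine-in-v u) g)
  , (λ v → WHT-affine-twist (λ u → π u v) (π-affine-in-u v) (π-invertible-in-u v)
                            (λ u → φ u v) (φ-affine-in-u v) g)
  where open Twist R q ζ ζ^q≈1 n using (WHT-affine-twist)
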